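{- Let $a,b,c$ be pairwise coprime positive integers with $a<b<c$ and $a\mid b+c$, let $S=\langle a,b,c\rangle$, and let $k_1$ be the least positive integer with $k_1 b\in\langle a,c\rangle$. Put $d_{1,1}=c(a-k_1)$ and $d_{a,1}=b(k_1-1)$ (the first entries of rows $1$ and $a$ of the table below), and let $R_1(a,b,c)$ be the set of ideals $I$ of $S$ such that $d_{1,1}\in I$ or $d_{a,1}\in I$. Then \[I(a,b,c;q)=\frac{1}{1-q^a}\sum_{I\in R_1(a,b,c)}q^{\operatorname{codim}(I)}.\]
   Context: A non-empty set $I\subseteq S$ is an ideal of $S$ if $I+S\subseteq I$; its codimension is $\operatorname{codim}(I)=|S\setminus I|$; $I(a,b,c;q)=\sum_I q^{\operatorname{codim}(I)}$ over all ideals $I$ of $\langle a,b,c\rangle$. The table: for $i\in\{1,\ldots,a\}$, $j\geq1$, $d_{i,j}=c(a+1-k_1-i)+a(j-1)$ if $1\leq i\leq a-k_1$; $d_{i,j}=a(j-1)$ if $i=a-k_1+1$; $d_{i,j}=b(i+k_1-a-1)+a(j-1)$ if $a-k_1+2\leq i\leq a$. For an ideal $I$, $d_k(I)=|\{d_{k,j}:j\geq1\}\setminus I|$. In general the paper defines $R_k(a,b,c)$ as the ideals $I$ with $d_j(I)\geq k-1$ for all $j\in\{1,\ldots,a\}$ and with $d_{1,k}\in I$ or $d_{a,k}\in I$; for $k=1$ this is the set described in the claim. -}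

module Defs where

open import Data.Nat using (ℕ; zero; suc; _+_; _*_; _∸_; _<_; _≤_; _≤ᵇ_)
open import Data.Bool using (Bool; true; false)
open import Data.List using (List; length)
open import Data.List.Relation.Unary.All using (All)
open import Data.List.Relation.Unary.Any using (Any)
open import Data.List.Relation.Unary.AllPairs using (AllPairs)
open import Data.Product using (Σ; ∃; _×_; _,_)
open import Data.Sum using (_⊎_)
open import Relation.Nullary using (¬_)
open import Relation.Binary.PropositionalEquality using (_≡_)

Counts : {A : Set} → (A → A → Set) → (A → Set) → ℕ → Set
Counts {A} _≈_ P m =
  Σ (List A) λ L →
    length L ≡ m
    × All P L
    × AllPairs (λ x y → ¬ (x ≈ y)) L
    × (∀ x → P x → Any (x ≈_) L)

InS : ℕ → ℕ → ℕ → ℕ → Set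
InS a b c x = ∃ λ i → ∃ λ j → ∃ λ k → x ≡ i * a + j * b + k * c

InS2 : ℕ → ℕ → ℕ → Set
InS2 a c x = ∃ λ i → ∃ λ k → x ≡ i * a + k * c

Subset : Set
Subset = ℕ → Bool

_≐_ : Subset → Subset → Set
I ≐ J = ∀ x → I x ≡ J x

IsIdeal : ℕ → ℕ → ℕ → Subset → Set
IsIdeal a b c I =
  (∃ λ x → I x ≡ true)
  × (∀ x → I x ≡ true → InS a b c x)
  × (∀ x s → I x ≡ true → InS a b c s → I (x + s) ≡ true)

CodimIs : ℕ → ℕ → ℕ → Subset → ℕ → Set
CodimIs a b c I n = Counts _≡_ (λ x → InS a b c x × I x ≡ false) n

IsK1 : ℕ → ℕ → ℕ → ℕ → Set
IsK1 a b c k =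
  0 < k × InS2 a c (k * b) × (∀ k' → 0 < k' → k' < k → ¬ InS2 a c (k' * b))

InR1 : ℕ → ℕ → ℕ → ℕ → Subset → Set
InR1 a b c k₁ I = IsIdeal a b c I × (I (c * (a ∸ k₁)) ≡ true ⊎ I (b * (k₁ ∸ 1)) ≡ true)

-- coefficient of q^n in q^a · F(q), for F with coefficients f
shiftCoeff : ℕ → (ℕ → ℕ) → ℕ → ℕ
shiftCoeff a f n with a ≤ᵇ n
... | true = f (n ∸ a)
... | false = 0

-- Every element of the Apéry set Ap(S; a) = {j b : j < k₁} ∪ {k c : 1 ≤ k ≤ a − k₁} lies below, in the
-- order of S, one of the corners d₁₁ = c (a − k₁) and d_{a,1} = b (k₁ − 1), which are themselves in Ap(S; a).
-- Hence an ideal outside R₁(a,b,c) avoids Ap(S; a), i.e. lies in a + S, and I ↦ I − a is a bijection from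
-- these ideals of codimension n onto the ideals of codimension n − a, because |Ap(S; a)| = a. This is the
-- identity I(q) = Σ_{I ∈ R₁} q^codim(I) + q^a I(q). The counts exist at all since an ideal of codimension n
-- contains every element of S from n (a + b + c) on, which leaves finitely many candidates.
module Submission where

open import Defs
open import Data.Nat using (ℕ; _+_; _<_)
open import Data.Nat.Coprimality using (Coprime)
open import Data.Nat.Divisibility using (_∣_)
open import Data.Product using (Σ; _×_)
open import Relation.Binary.PropositionalEquality using (_≡_)

open import Data.Nat using (zero; suc; _*_; _∸_; _≤_; _≤ᵇ_; s≤s; z≤n; NonZero; >-nonZero; _≟_)
open import Data.Nat.Properties
open import Data.Nat.Coprimality using (coprime-divisor)
import Data.Nat.Coprimality as Coprime
open import Data.Nat.Divisibility using (divides; ∣⇒≤; ∣m+n∣m⇒∣n)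
open import Data.Nat.Tactic.RingSolver using (solve)
open import Data.Bool using (Bool; true; false)
import Data.Bool.Properties as Boolₚ
open import Data.Fin using (Fin)
import Data.Fin as Fin
open import Data.Fin.Properties using (pigeonhole)
open import Data.List using (List; []; _∷_; length; _++_; map; filter; applyUpTo; upTo)
import Data.List as List
open import Data.List.Properties using (length-++; length-map; length-applyUpTo)
open import Data.List.Relation.Unary.All as All using (All)
import Data.List.Relation.Unary.All.Properties as Allₚ
open import Data.List.Relation.Unary.AllPairs as AllPairs using (AllPairs)
import Data.List.Relation.Unary.AllPairs.Properties as AllPairsₚ
open import Data.List.Relation.Unary.Any as Any using (here)
import Data.List.Relation.Unary.Any.Properties as Anyₚ
open import Data.List.Membership.Setoid.Properties
  using (∈-++⁺ˡ; ∈-++⁺ʳ; ∈-map⁺; ∈-resp-≈; ∈-applyUpTo⁺; index-injective)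
import Data.List.Relation.Unary.Unique.Setoid.Properties as Uniqueₚ
open import Data.Product using (∃; _,_; proj₁; proj₂)
open import Data.Sum as Sum using (_⊎_; inj₁; inj₂; [_,_]′)
open import Data.Empty using (⊥-elim)
open import Level using (0ℓ)
open import Relation.Binary.Bundles using (Setoid)
open import Relation.Binary.PropositionalEquality
open import Relation.Nullary using (¬_; yes; no; Dec; does; ofʸ; ofⁿ)
open import Relation.Nullary.Decidable using (map′; _×-dec_; _→-dec_; _⊎-dec_; dec-true; dec-false)
open import Relation.Unary using (Decidable)

-- Counting up to an equivalence

module SetoidCounting (A : Setoid 0ℓ 0ℓ) where

  open Setoid A using (_≈_) renaming (Carrier to X)
  -- Kept local: overloading [] and _∷_ at top level makes the variable lists passed to solve ambiguous.
  open import Data.List.Relation.Unary.All using ([]; _∷_)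
  open import Data.List.Relation.Unary.AllPairs using ([]; _∷_)
  open import Data.List.Membership.Setoid A using (_∈_)
  open import Data.List.Relation.Unary.Unique.Setoid A using (Unique)

  Enumerates : (X → Set) → List X → Set
  Enumerates P L = All P L × Unique L × (∀ x → P x → x ∈ L)

  private
    All-lookup : ∀ {P : X → Set} {L} → All P L → (i : Fin (length L)) → P (List.lookup L i)
    All-lookup (px ∷ _) Fin.zero = px
    All-lookup (_ ∷ pxs) (Fin.suc i) = All-lookup pxs i

    Unique-lookup : ∀ {L} → Unique L → ∀ {i j : Fin (length L)} → i Fin.< j →
                    ¬ (List.lookup L i ≈ List.lookup L j)
    Unique-lookup (x≉ ∷ _) {Fin.zero} {Fin.suc j} _ = All-lookup x≉ j
    Unique-lookup (_ ∷ u) {Fin.suc i} {Fin.suc j} (s≤s i<j) = Unique-lookup u i<j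

  -- Pigeonhole: sending each element of L₁ to the position of its representative in L₂ is injective.
  length-mono : ∀ {P : X → Set} {L₁ L₂} → All P L₁ → Unique L₁ → (∀ x → P x → x ∈ L₂) →
                length L₁ ≤ length L₂
  length-mono {P} {L₁} {L₂} all₁ unique₁ cover₂ = ≮⇒≥ λ L₂<L₁ →
    let (i , j , i<j , same-position) = pigeonhole L₂<L₁ position in
    Unique-lookup unique₁ i<j (index-injective A (represented i) (represented j) same-position)
    where
    represented : (i : Fin (length L₁)) → List.lookup L₁ i ∈ L₂
    represented i = cover₂ _ (All-lookup all₁ i)
    position : Fin (length L₁) → Fin (length L₂)
    position i = Any.index (represented i)

  Counts-mono : ∀ {P Q : X → Set} {m n} → (∀ x → P x → Q x) → Counts _≈_ P m → Counts _≈_ Q n → m ≤ n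
  Counts-mono P⊆Q (L₁ , refl , all₁ , unique₁ , _) (L₂ , refl , _ , _ , cover₂) =
    length-mono (All.map (P⊆Q _) all₁) unique₁ cover₂

  Counts-unique : ∀ {P : X → Set} {m n} → Counts _≈_ P m → Counts _≈_ P n → m ≡ n
  Counts-unique p q = ≤-antisym (Counts-mono (λ _ px → px) p q) (Counts-mono (λ _ px → px) q p)

  Enumerates-cong : ∀ {P Q : X → Set} {L} → (∀ x → P x → Q x) → (∀ x → Q x → P x) →
                    Enumerates P L → Enumerates Q L
  Enumerates-cong P⇒Q Q⇒P (all , unique , cover) =
    All.map (P⇒Q _) all , unique , λ x qx → cover x (Q⇒P x qx)

  Counts-cong : ∀ {P Q : X → Set} {m} → (∀ x → P x → Q x) → (∀ x → Q x → P x) →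
                Counts _≈_ P m → Counts _≈_ Q m
  Counts-cong P⇒Q Q⇒P (L , len , enumerates) = L , len , Enumerates-cong P⇒Q Q⇒P enumerates

  Counts-∅ : ∀ {P : X → Set} → (∀ x → ¬ P x) → Counts _≈_ P 0
  Counts-∅ ¬P = [] , refl , [] , [] , λ x px → ⊥-elim (¬P x px)

  Counts-⊎ : ∀ {P Q : X → Set} {m n} → (∀ {x y} → P x → Q y → ¬ (x ≈ y)) →
             Counts _≈_ P m → Counts _≈_ Q n → Counts _≈_ (λ x → P x ⊎ Q x) (m + n)
  Counts-⊎ P#Q (L₁ , refl , all₁ , unique₁ , cover₁) (L₂ , refl , all₂ , unique₂ , cover₂) =
    L₁ ++ L₂ , length-++ L₁ ,
    Allₚ.++⁺ (All.map inj₁ all₁) (All.map inj₂ all₂) ,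
    AllPairsₚ.++⁺ unique₁ unique₂ (All.map (λ px → All.map (P#Q px) all₂) all₁) ,
    λ x → [ (λ px → ∈-++⁺ˡ A (cover₁ x px)) , (λ qx → ∈-++⁺ʳ A L₁ (cover₂ x qx)) ]′

  Enumerates-filter : ∀ {P Q : X → Set} (Q? : Decidable Q) {L} →
                      (∀ {x y} → P x → Q x → x ≈ y → Q y) →
                      Enumerates P L → Enumerates (λ x → P x × Q x) (filter Q? L)
  Enumerates-filter Q? {L} Q-transfer (all , unique , cover) =
    All.zip (Allₚ.filter⁺ Q? all , Allₚ.all-filter Q? L) ,
    Uniqueₚ.filter⁺ A Q? unique ,
    λ x (px , qx) → let x∈L = cover x px in
      [ (λ x∈filter → x∈filter) , (λ ¬Qy → ⊥-elim (¬Qy (Q-transfer px qx (Anyₚ.lookup-index x∈L)))) ]′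
        (Anyₚ.filter⁺ Q? x∈L)

module _ (A B : Setoid 0ℓ 0ℓ) where

  open Setoid A using () renaming (Carrier to X; _≈_ to _≈₁_)
  open Setoid B using () renaming (Carrier to Y; _≈_ to _≈₂_)

  Counts-map : ∀ {P : X → Set} {Q : Y → Set} {m} (F : X → Y) →
               (∀ {x y} → x ≈₁ y → F x ≈₂ F y) → (∀ {x y} → F x ≈₂ F y → x ≈₁ y) →
               (∀ x → P x → Q (F x)) → (∀ y → Q y → ∃ λ x → P x × y ≈₂ F x) →
               Counts _≈₁_ P m → Counts _≈₂_ Q m
  Counts-map F F-cong F-injective P⇒Q Q⇒P (L , refl , all , unique , cover) =
    map F L , length-map F L , Allₚ.map⁺ (All.map (P⇒Q _) all) ,
    Uniqueₚ.map⁺ A B F-injective unique ,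
    λ y qy → let (x , px , y≈Fx) = Q⇒P y qy in
      ∈-resp-≈ B (Setoid.sym B y≈Fx) (∈-map⁺ A B F-cong (cover x px))

module ℕ-Counting where

  open SetoidCounting (setoid ℕ) public

  Counts-applyUpTo : ∀ (f : ℕ → ℕ) m → (∀ {i j} → f i ≡ f j → i ≡ j) →
                     Counts _≡_ (λ x → ∃ λ i → i < m × x ≡ f i) m
  Counts-applyUpTo f m f-injective =
    applyUpTo f m , length-applyUpTo f m ,
    Allₚ.applyUpTo⁺₁ f m (λ i<m → _ , i<m , refl) ,
    Uniqueₚ.applyUpTo⁺₁ (setoid ℕ) f m (λ i<j _ fi≡fj → <⇒≢ i<j (f-injective fi≡fj)) ,
    λ { x (i , i<m , refl) → ∈-applyUpTo⁺ (setoid ℕ) f i<m }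

  Counts-bounded : ∀ {P : ℕ → Set} (P? : Decidable P) B → (∀ {x} → P x → x < B) →
                   Counts _≡_ P (length (filter P? (upTo B)))
  Counts-bounded P? B P<B = Counts-cong (λ x → proj₂) (λ x px → P<B px , px)
    (filter P? (upTo B) , refl , Enumerates-filter P? (λ { _ px refl → px }) upTo-enumerates)
    where
    upTo-enumerates : Enumerates (_< B) (upTo B)
    upTo-enumerates = Allₚ.applyUpTo⁺₁ (λ x → x) B (λ x<B → x<B) ,
      Uniqueₚ.applyUpTo⁺₁ (setoid ℕ) (λ x → x) B (λ i<j _ → <⇒≢ i<j) ,
      λ x x<B → ∈-applyUpTo⁺ (setoid ℕ) (λ x → x) x<B

-- Subsets agreeing with a given one from a bound on

true≢false : true ≢ false
true≢false ()

≐-setoid : Setoid 0ℓ 0ℓ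
≐-setoid = ℕ →-setoid Bool

open import Data.List.Membership.Setoid ≐-setoid using (_∈_)
module ≐-Counting = SetoidCounting ≐-setoid

override : ℕ → Bool → Subset → Subset
override p β f x with x ≟ p
... | yes _ = β
... | no _ = f x

override-at : ∀ p β f → override p β f p ≡ β
override-at p β f with p ≟ p
... | yes _ = refl
... | no p≢p = ⊥-elim (p≢p refl)

override-elsewhere : ∀ {p x} β f → x ≢ p → override p β f x ≡ f x
override-elsewhere {p} {x} β f x≢p with x ≟ p
... | yes x≡p = ⊥-elim (x≢p x≡p)
... | no _ = refl

override-cong : ∀ p β {f f′} → f ≐ f′ → override p β f ≐ override p β f′
override-cong p β f≐f′ x with x ≟ p
... | yes _ = refl
... | no _ = f≐f′ x

override-restore : ∀ p β f → override p (f p) (override p β f) ≐ f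
override-restore p β f x = by-cases (x ≟ p)
  where
  by-cases : Dec (x ≡ p) → override p (f p) (override p β f) x ≡ f x
  by-cases (yes refl) = override-at p (f p) (override p β f)
  by-cases (no x≢p) = trans (override-elsewhere (f p) (override p β f) x≢p) (override-elsewhere β f x≢p)

AgreeFrom : ℕ → Subset → Subset → Set
AgreeFrom B f g = ∀ x → B ≤ x → f x ≡ g x

DifferBelow : ℕ → Subset → Subset → Set
DifferBelow B f g = ∃ λ x → x < B × f x ≢ g x

patches : Subset → ℕ → List Subset
patches g zero = g ∷ []
patches g (suc B) = map (override B true) (patches g B) ++ map (override B false) (patches g B)

patches-agree : ∀ g B → All (λ f → AgreeFrom B f g) (patches g B)
patches-agree g zero = (λ _ _ → refl) All.∷ All.[]
patches-agree g (suc B) =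
  Allₚ.++⁺ (Allₚ.map⁺ (All.map (override-agrees true) (patches-agree g B)))
           (Allₚ.map⁺ (All.map (override-agrees false) (patches-agree g B)))
  where
  override-agrees : ∀ β {f} → AgreeFrom B f g → AgreeFrom (suc B) (override B β f) g
  override-agrees β {f} agree x B<x =
    trans (override-elsewhere β f (λ { refl → <-irrefl refl B<x })) (agree x (≤-trans (n≤1+n B) B<x))

patches-differ : ∀ g B → AllPairs (DifferBelow B) (patches g B)
patches-differ g zero = All.[] AllPairs.∷ AllPairs.[]
patches-differ g (suc B) =
  AllPairsₚ.++⁺ (AllPairsₚ.map⁺ (AllPairs.map (override-differs true) (patches-differ g B)))
                (AllPairsₚ.map⁺ (AllPairs.map (override-differs false) (patches-differ g B)))
                (Allₚ.map⁺ (All.universal (λ f → Allₚ.map⁺ (All.universal (differ-at-B f) _)) _))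
  where
  override-differs : ∀ β {f f′} → DifferBelow B f f′ → DifferBelow (suc B) (override B β f) (override B β f′)
  override-differs β {f} {f′} (x , x<B , fx≢f′x) =
    x , ≤-trans x<B (n≤1+n B) ,
    λ e → fx≢f′x (trans (sym (override-elsewhere β f x≢B)) (trans e (override-elsewhere β f′ x≢B)))
    where
    x≢B : x ≢ B
    x≢B refl = <-irrefl refl x<B
  differ-at-B : ∀ f f′ → DifferBelow (suc B) (override B true f) (override B false f′)
  differ-at-B f f′ = B , ≤-refl , λ e → true≢false (trans (sym (override-at B true f)) (trans e (override-at B false f′)))

patches-complete : ∀ g B {f} → AgreeFrom B f g → f ∈ patches g B
patches-complete g zero agree = here (λ x → agree x z≤n)
patches-complete g (suc B) {f} agree = ∈-resp-≈ ≐-setoid (override-restore B (g B) f) (in-half (f B))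
  where
  lowered-agrees : AgreeFrom B (override B (g B) f) g
  lowered-agrees x B≤x with x ≟ B
  ... | yes refl = refl
  ... | no x≢B = agree x (≤∧≢⇒< B≤x (≢-sym x≢B))
  lowered∈ : override B (g B) f ∈ patches g B
  lowered∈ = patches-complete g B lowered-agrees
  in-half : ∀ β → override B β (override B (g B) f) ∈ patches g (suc B)
  in-half true = ∈-++⁺ˡ ≐-setoid (∈-map⁺ ≐-setoid ≐-setoid (override-cong B true) lowered∈)
  in-half false = ∈-++⁺ʳ ≐-setoid (map (override B true) (patches g B))
                    (∈-map⁺ ≐-setoid ≐-setoid (override-cong B false) lowered∈)

patches-enumerate : ∀ g B → ≐-Counting.Enumerates (λ f → AgreeFrom B f g) (patches g B)
patches-enumerate g B =
  patches-agree g B ,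
  AllPairs.map (λ (x , _ , fx≢f′x) f≐f′ → fx≢f′x (f≐f′ x)) (patches-differ g B) ,
  λ f → patches-complete g B

-- The semigroup ⟨a, b, c⟩ and its ideals

module Semigroup (a b c : ℕ) where

  open ℕ-Counting

  S : ℕ → Set
  S = InS a b c

  S-+ : ∀ {x y} → S x → S y → S (x + y)
  S-+ (i , j , k , refl) (i′ , j′ , k′ , refl) =
    i + i′ , j + j′ , k + k′ , solve (i ∷ j ∷ k ∷ i′ ∷ j′ ∷ k′ ∷ a ∷ b ∷ c ∷ [])

  S-0 : S 0
  S-0 = 0 , 0 , 0 , refl

  S-a : S a
  S-a = 1 , 0 , 0 , solve (a ∷ b ∷ c ∷ [])

  S-b : S b
  S-b = 0 , 1 , 0 , solve (a ∷ b ∷ c ∷ [])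

  S-c : S c
  S-c = 0 , 0 , 1 , solve (a ∷ b ∷ c ∷ [])

  S-* : ∀ r {x} → S x → S (r * x)
  S-* zero Sx = S-0
  S-* (suc r) Sx = S-+ Sx (S-* r Sx)

  infix 4 _≼_
  _≼_ : ℕ → ℕ → Set
  x ≼ y = ∃ λ s → S s × y ≡ x + s

  Apéry : ℕ → Set
  Apéry x = S x × ¬ (a ≼ x)

  ≼-+ʳ : ∀ {x y z} → x ≼ y → S z → x ≼ y + z
  ≼-+ʳ {x} {z = z} (s , Ss , refl) Sz = s + z , S-+ Ss Sz , +-assoc x s z

  ≼-≡-trans : ∀ {x y z} → x ≼ y → y ≡ z → x ≼ z
  ≼-≡-trans x≼y refl = x≼y

  +-monoˡ-≼ : ∀ {x y} w → x ≼ y → x + w ≼ y + w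
  +-monoˡ-≼ {x} w (s , Ss , refl) = s , Ss , solve (x ∷ s ∷ w ∷ [])

  *-monoˡ-≼ : ∀ {d i j} → S d → i ≤ j → i * d ≼ j * d
  *-monoˡ-≼ {d} {i} Sd i≤j with r , refl ← m≤n⇒∃[o]m+o≡n i≤j = r * d , S-* r Sd , *-distribʳ-+ d i r

  a≼ : ∀ i j k → a ≼ suc i * a + j * b + k * c
  a≼ i j k = i * a + j * b + k * c , (i , j , k , refl) , solve (i ∷ j ∷ k ∷ a ∷ b ∷ c ∷ [])

  Ideal : Subset → Set
  Ideal = IsIdeal a b c

  Codim : Subset → ℕ → Set
  Codim = CodimIs a b c

  IdealOfCodim : ℕ → Subset → Set
  IdealOfCodim n I = Ideal I × Codim I n

  Avoids : Subset → (ℕ → Set) → Set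
  Avoids I P = ∀ {x} → P x → I x ≡ false

  ideal-upward-closed : ∀ {I x y} → Ideal I → I x ≡ true → x ≼ y → I y ≡ true
  ideal-upward-closed (_ , _ , closed) Ix (s , Ss , refl) = closed _ s Ix Ss

  ideal-cong : ∀ {I J} → I ≐ J → Ideal I → Ideal J
  ideal-cong I≐J ((x , Ix) , I⊆S , closed) =
    (x , trans (sym (I≐J x)) Ix) ,
    (λ y Jy → I⊆S y (trans (I≐J y) Jy)) ,
    (λ y s Jy Ss → trans (sym (I≐J (y + s))) (closed y s (trans (I≐J y) Jy) Ss))

  codim-cong : ∀ {I J n} → I ≐ J → Codim I n → Codim J n
  codim-cong I≐J = Counts-cong
    (λ x (Sx , Ix) → Sx , trans (sym (I≐J x)) Ix) (λ x (Sx , Jx) → Sx , trans (I≐J x) Jx)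

  shift : Subset → Subset
  shift J x with a ≤? x
  ... | yes _ = J (x ∸ a)
  ... | no _ = false

  shift-+ : ∀ J y → shift J (a + y) ≡ J y
  shift-+ J y with a ≤? a + y
  ... | yes _ = cong J (m+n∸m≡n a y)
  ... | no a≰a+y = ⊥-elim (a≰a+y (m≤m+n a y))

  shift-true : ∀ J x → shift J x ≡ true → ∃ λ y → x ≡ a + y × J y ≡ true
  shift-true J x Jx with a ≤? x
  ... | yes a≤x = x ∸ a , sym (m+[n∸m]≡n a≤x) , Jx

  shift-cong : ∀ {J J′} → J ≐ J′ → shift J ≐ shift J′
  shift-cong J≐J′ x with a ≤? x
  ... | yes _ = J≐J′ (x ∸ a)
  ... | no _ = refl

  shift-injective : ∀ {J J′} → shift J ≐ shift J′ → J ≐ J′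
  shift-injective {J} {J′} e y = trans (sym (shift-+ J y)) (trans (e (a + y)) (shift-+ J′ y))

  shift-ideal : ∀ {J} → Ideal J → Ideal (shift J)
  shift-ideal {J} ((x , Jx) , J⊆S , closed) =
    (a + x , trans (shift-+ J x) Jx) , shift⊆S , shift-closed
    where
    shift⊆S : ∀ x → shift J x ≡ true → S x
    shift⊆S x e with shift-true J x e
    ... | y , refl , Jy = S-+ S-a (J⊆S y Jy)
    shift-closed : ∀ x s → shift J x ≡ true → S s → shift J (x + s) ≡ true
    shift-closed x s e Ss with shift-true J x e
    ... | y , refl , Jy = trans (cong (shift J) (+-assoc a y s)) (trans (shift-+ J (y + s)) (closed y s Jy Ss))

  shift-avoids-Apéry : ∀ {J} → Ideal J → Avoids (shift J) Apéry
  shift-avoids-Apéry {J} (_ , J⊆S , _) {x} (_ , a⋠x) with shift J x in e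
  ... | false = refl
  ... | true with shift-true J x e
  ...   | y , refl , Jy = ⊥-elim (a⋠x (y , J⊆S y Jy , refl))

  unshift : Subset → Subset
  unshift I y = I (a + y)

  module _ ⦃ _ : NonZero a ⦄ ⦃ _ : NonZero b ⦄ ⦃ _ : NonZero c ⦄ where

    S? : Decidable S
    S? x = map′ (λ (i , _ , j , _ , k , _ , e) → i , j , k , e)
                (λ (i , j , k , e) → let (i≤x , j≤x , k≤x) = coefficients-≤ e in
                  i , s≤s i≤x , j , s≤s j≤x , k , s≤s k≤x , e)
                (anyUpTo? (λ i → anyUpTo? (λ j → anyUpTo? (λ k → x ≟ i * a + j * b + k * c) (suc x)) (suc x)) (suc x))
      where
      coefficients-≤ : ∀ {i j k} → x ≡ i * a + j * b + k * c → i ≤ x × j ≤ x × k ≤ x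
      coefficients-≤ {i} {j} {k} refl =
        ≤-trans (m≤m*n i a) (≤-trans (m≤m+n (i * a) (j * b)) (m≤m+n _ (k * c))) ,
        ≤-trans (m≤m*n j b) (≤-trans (m≤n+m (j * b) (i * a)) (m≤m+n _ (k * c))) ,
        ≤-trans (m≤m*n k c) (m≤n+m (k * c) _)

    a≼? : Decidable (a ≼_)
    a≼? x with a ≤? x
    ... | no a≰x = no λ (y , _ , x≡a+y) → a≰x (subst (a ≤_) (sym x≡a+y) (m≤m+n a y))
    ... | yes a≤x = map′ (λ Sx∸a → x ∸ a , Sx∸a , sym (m+[n∸m]≡n a≤x))
                         (λ (y , Sy , x≡a+y) → subst S (sym (trans (cong (_∸ a) x≡a+y) (m+n∸m≡n a y))) Sy)
                         (S? (x ∸ a))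

    avoids-Apéry⇒≽a : ∀ {I x} → Ideal I → Avoids I Apéry → I x ≡ true → a ≼ x
    avoids-Apéry⇒≽a {I} {x} (_ , I⊆S , _) avoids Ix with a≼? x
    ... | yes a≼x = a≼x
    ... | no a⋠x = ⊥-elim (true≢false (trans (sym Ix) (avoids (I⊆S x Ix , a⋠x))))

    shift-unshift : ∀ {I} → Ideal I → Avoids I Apéry → I ≐ shift (unshift I)
    shift-unshift {I} ideal avoids x with a ≤? x
    ... | yes a≤x = cong I (sym (m+[n∸m]≡n a≤x))
    ... | no a≰x with I x in Ix
    ...   | false = refl
    ...   | true with avoids-Apéry⇒≽a ideal avoids Ix
    ...     | y , _ , refl = ⊥-elim (a≰x (m≤m+n a y))

    unshift-ideal : ∀ {I} → Ideal I → Avoids I Apéry → Ideal (unshift I)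
    unshift-ideal {I} ideal@((x , Ix) , I⊆S , closed) avoids =
      nonempty , unshift⊆S , λ y s Iy Ss → trans (cong I (sym (+-assoc a y s))) (closed (a + y) s Iy Ss)
      where
      nonempty : ∃ λ y → I (a + y) ≡ true
      nonempty with avoids-Apéry⇒≽a ideal avoids Ix
      ... | y , _ , refl = y , Ix
      unshift⊆S : ∀ y → I (a + y) ≡ true → S y
      unshift⊆S y Iy with avoids-Apéry⇒≽a ideal avoids Iy
      ... | s , Ss , a+y≡a+s = subst S (sym (+-cancelˡ-≡ a y s a+y≡a+s)) Ss

    codim-split : ∀ {I m n} → Counts _≡_ Apéry m → Avoids I Apéry → Codim (unshift I) n → Codim I (m + n)
    codim-split {I} {m} {n} apéry avoids codim = Counts-cong to from (Counts-⊎ disjoint apéry shifted)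
      where
      Shifted : ℕ → Set
      Shifted x = ∃ λ y → (S y × I (a + y) ≡ false) × x ≡ a + y
      shifted : Counts _≡_ Shifted n
      shifted = Counts-map (setoid ℕ) (setoid ℕ) (a +_) (cong (a +_)) (+-cancelˡ-≡ a _ _)
                  (λ y gap → y , gap , refl) (λ x shifted → shifted) codim
      disjoint : ∀ {x x′} → Apéry x → Shifted x′ → x ≢ x′
      disjoint (_ , a⋠x) (y , (Sy , _) , refl) refl = a⋠x (y , Sy , refl)
      to : ∀ x → Apéry x ⊎ Shifted x → S x × I x ≡ false
      to x (inj₁ apx) = proj₁ apx , avoids apx
      to x (inj₂ (y , (Sy , Iy) , refl)) = S-+ S-a Sy , Iy
      from : ∀ x → S x × I x ≡ false → Apéry x ⊎ Shifted x
      from x (Sx , Ix) with a≼? x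
      ... | no a⋠x = inj₁ (Sx , a⋠x)
      ... | yes (y , Sy , refl) = inj₂ (y , (Sy , Ix) , refl)

    -- If i d + w is a gap then so is every t d + w with t ≤ i: these are i + 1 distinct gaps.
    gap-coefficient-< : ∀ {I n d w i} ⦃ _ : NonZero d ⦄ → Ideal I → Codim I n → S d → S w →
                        I (i * d + w) ≡ false → i < n
    gap-coefficient-< {I} {n} {d} {w} {i} ideal codim Sd Sw gap =
      Counts-mono below-gap (Counts-applyUpTo (λ t → t * d + w) (suc i) injective) codim
      where
      injective : ∀ {t t′} → t * d + w ≡ t′ * d + w → t ≡ t′
      injective {t} {t′} e = *-cancelʳ-≡ t t′ d (+-cancelʳ-≡ w _ _ e)
      below-gap : ∀ x → (∃ λ t → t < suc i × x ≡ t * d + w) → S x × I x ≡ false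
      below-gap x (t , t≤i , refl) with I (t * d + w) in It
      ... | false = S-+ (S-* t Sd) Sw , refl
      ... | true = ⊥-elim (true≢false (trans (sym (ideal-upward-closed ideal It
                     (+-monoˡ-≼ w (*-monoˡ-≼ Sd (≤-pred t≤i))))) gap))

    gapBound : ℕ → ℕ
    gapBound n = n * a + n * b + n * c

    gap-<-gapBound : ∀ {I n x} → Ideal I → Codim I n → S x → I x ≡ false → x < gapBound n
    gap-<-gapBound {I} {n} ideal codim (i , j , k , refl) gap =
      +-mono-< (+-mono-< (*-monoˡ-< a i<n) (*-monoˡ-< b j<n)) (*-monoˡ-< c k<n)
      where
      i<n : i < n
      i<n = gap-coefficient-< ideal codim S-a (S-+ (S-* j S-b) (S-* k S-c))
              (trans (cong I (sym (+-assoc (i * a) (j * b) (k * c)))) gap)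
      b-term-first : j * b + (i * a + k * c) ≡ i * a + j * b + k * c
      b-term-first = solve (i ∷ j ∷ k ∷ a ∷ b ∷ c ∷ [])
      j<n : j < n
      j<n = gap-coefficient-< ideal codim S-b (S-+ (S-* i S-a) (S-* k S-c))
              (trans (cong I b-term-first) gap)
      k<n : k < n
      k<n = gap-coefficient-< ideal codim S-c (S-+ (S-* i S-a) (S-* j S-b))
              (trans (cong I (+-comm (k * c) (i * a + j * b))) gap)

    ideal-contains-large : ∀ {I n x} → Ideal I → Codim I n → S x → gapBound n ≤ x → I x ≡ true
    ideal-contains-large {I} {n} {x} ideal codim Sx bound≤x with I x in Ix
    ... | true = refl
    ... | false = ⊥-elim (<⇒≱ (gap-<-gapBound ideal codim Sx Ix) bound≤x)

    gap? : (I : Subset) → Decidable (λ x → S x × I x ≡ false)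
    gap? I x = S? x ×-dec (I x Boolₚ.≟ false)

    gapCount : ℕ → Subset → ℕ
    gapCount B I = length (filter (gap? I) (upTo B))

    codim-gapCount : ∀ {I} B → (∀ {x} → S x → I x ≡ false → x < B) → Codim I (gapCount B I)
    codim-gapCount {I} B gaps<B = Counts-bounded (gap? I) B (λ (Sx , Ix) → gaps<B Sx Ix)

    unshift-codim : ∀ {I m n} → Counts _≡_ Apéry m → Ideal I → Avoids I Apéry → Codim I n →
                    m ≤ n × Codim (unshift I) (n ∸ m)
    unshift-codim {I} {m} {n} apéry ideal avoids codim =
      subst (m ≤_) (sym n≡m+g) (m≤m+n m g) ,
      subst (Codim (unshift I)) (sym (trans (cong (_∸ m) n≡m+g) (m+n∸m≡n m g))) unshift-codim-g
      where
      unshift-gaps-< : ∀ {y} → S y → I (a + y) ≡ false → y < gapBound n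
      unshift-gaps-< Sy Iy = ≤-<-trans (m≤n+m _ a) (gap-<-gapBound ideal codim (S-+ S-a Sy) Iy)
      g : ℕ
      g = gapCount (gapBound n) (unshift I)
      unshift-codim-g : Codim (unshift I) g
      unshift-codim-g = codim-gapCount (gapBound n) unshift-gaps-<
      n≡m+g : n ≡ m + g
      n≡m+g = Counts-unique codim (codim-split apéry avoids unshift-codim-g)

    avoiding-ideals-count : ∀ {m n N} → Counts _≡_ Apéry m → Counts _≐_ (IdealOfCodim n) N →
                            Counts _≐_ (λ I → IdealOfCodim (m + n) I × Avoids I Apéry) N
    avoiding-ideals-count {m} {n} apéry =
      Counts-map ≐-setoid ≐-setoid shift shift-cong shift-injective
        (λ J (ideal , codim) → let avoids = shift-avoids-Apéry ideal in
          (shift-ideal ideal , codim-split apéry avoids (codim-cong (λ y → sym (shift-+ J y)) codim)) , avoids)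
        (λ I ((ideal , codim) , avoids) →
          unshift I ,
          (unshift-ideal ideal avoids ,
           subst (Codim (unshift I)) (m+n∸m≡n m n) (proj₂ (unshift-codim apéry ideal avoids codim))) ,
          shift-unshift ideal avoids)

    inS : Subset
    inS x = does (S? x)

    inS-sound : ∀ {x} → inS x ≡ true → S x
    inS-sound {x} = does-true (S? x)
      where
      does-true : ∀ {A : Set} (d : Dec A) → does d ≡ true → A
      does-true (yes a) _ = a

    IdealTest : ℕ → ℕ → Subset → Set
    IdealTest B n f = (∀ {x} → x < B → f x ≡ true → S x)
                    × (∀ {x} → x < B → ∀ {s} → s < B → f x ≡ true → S s → f (x + s) ≡ true)
                    × gapCount B f ≡ n

    IdealTest? : ∀ B n → Decidable (IdealTest B n)
    IdealTest? B n f =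
      allUpTo? (λ x → f x Boolₚ.≟ true →-dec S? x) B ×-dec
      allUpTo? (λ x → allUpTo? (λ s → f x Boolₚ.≟ true →-dec S? s →-dec f (x + s) Boolₚ.≟ true) B) B ×-dec
      gapCount B f ≟ n

    ideal-test-sound : ∀ {B n f} → AgreeFrom B f inS → IdealTest B n f → IdealOfCodim n f
    ideal-test-sound {B} {n} {f} agree (f⊆S , f-closed , gaps≡n) =
      ((B * a , trans (agree _ (m≤m*n B a)) (dec-true (S? _) (S-* B S-a))) , ⊆S , closed) ,
      subst (Codim f) gaps≡n (codim-gapCount B gaps<B)
      where
      ⊆S : ∀ x → f x ≡ true → S x
      ⊆S x fx with x <? B
      ... | yes x<B = f⊆S x<B fx
      ... | no x≮B = inS-sound (trans (sym (agree x (≮⇒≥ x≮B))) fx)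
      closed : ∀ x s → f x ≡ true → S s → f (x + s) ≡ true
      closed x s fx Ss with x + s <? B
      ... | yes x+s<B = f-closed (≤-<-trans (m≤m+n x s) x+s<B) (≤-<-trans (m≤n+m s x) x+s<B) fx Ss
      ... | no x+s≮B = trans (agree (x + s) (≮⇒≥ x+s≮B)) (dec-true (S? (x + s)) (S-+ (⊆S x fx) Ss))
      gaps<B : ∀ {x} → S x → f x ≡ false → x < B
      gaps<B {x} Sx fx with x <? B
      ... | yes x<B = x<B
      ... | no x≮B = ⊥-elim (true≢false (trans (sym (dec-true (S? x) Sx)) (trans (sym (agree x (≮⇒≥ x≮B))) fx)))

    ideal-test-complete : ∀ {n f} → IdealOfCodim n f → IdealTest (gapBound n) n f
    ideal-test-complete {n} (ideal@(_ , f⊆S , closed) , codim) =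
      (λ {x} _ → f⊆S x) , (λ {x} _ {s} _ → closed x s) ,
      Counts-unique (codim-gapCount (gapBound n) (gap-<-gapBound ideal codim)) codim

    ideal-agrees-with-S : ∀ {n I} → IdealOfCodim n I → AgreeFrom (gapBound n) I inS
    ideal-agrees-with-S {n} {I} (ideal@(_ , I⊆S , _) , codim) x bound≤x with S? x
    ... | yes Sx = trans (ideal-contains-large ideal codim Sx bound≤x) (sym (dec-true (S? x) Sx))
    ... | no ¬Sx = trans I-outside-S (sym (dec-false (S? x) ¬Sx))
      where
      I-outside-S : I x ≡ false
      I-outside-S with I x in Ix
      ... | false = refl
      ... | true = ⊥-elim (¬Sx (I⊆S x Ix))

    ideals : ℕ → List Subset
    ideals n = filter (IdealTest? (gapBound n) n) (patches inS (gapBound n))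

    ideals-enumerate : ∀ n → ≐-Counting.Enumerates (IdealOfCodim n) (ideals n)
    ideals-enumerate n = ≐-Counting.Enumerates-cong (λ f (agree , test) → ideal-test-sound agree test)
      (λ I ideal → ideal-agrees-with-S ideal , ideal-test-complete ideal)
      (≐-Counting.Enumerates-filter (IdealTest? (gapBound n) n) transfer
        (patches-enumerate inS (gapBound n)))
      where
      transfer : ∀ {f g} → AgreeFrom (gapBound n) f inS → IdealTest (gapBound n) n f → f ≐ g → IdealTest (gapBound n) n g
      transfer agree test f≐g = let (ideal , codim) = ideal-test-sound agree test in
        ideal-test-complete (ideal-cong f≐g ideal , codim-cong f≐g codim)

-- The Apéry set of a under the hypotheses of the theorem

least-multiple-≤ : ∀ {a b c k₁} → 0 < a → (∀ q → 0 < q → q < k₁ → ¬ InS2 a c (q * b)) → k₁ ≤ a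
least-multiple-≤ {a} {b} {c} {k₁} 0<a k₁-minimal with k₁ ≤? a
... | yes k₁≤a = k₁≤a
... | no k₁≰a = ⊥-elim (k₁-minimal a 0<a (≰⇒> k₁≰a) (b , 0 , solve (a ∷ b ∷ c ∷ [])))

module AperySet (a b c : ℕ) (0<a : 0 < a) (a<b : a < b) (b<c : b < c)
  (a⊥c : Coprime a c) (b⊥c : Coprime b c) (t : ℕ) (b+c≡t*a : b + c ≡ t * a)
  (k₁ : ℕ) (0<k₁ : 0 < k₁) (i′ k′ : ℕ) (k₁*b≡ : k₁ * b ≡ i′ * a + k′ * c)
  (k₁-minimal : ∀ q → 0 < q → q < k₁ → ¬ InS2 a c (q * b))
  (m₀ : ℕ) (k₁+m₀≡a : k₁ + m₀ ≡ a) where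

  open Semigroup a b c

  instance
    a≢0 : NonZero a
    a≢0 = >-nonZero 0<a
    b≢0 : NonZero b
    b≢0 = >-nonZero (<-trans 0<a a<b)
    c≢0 : NonZero c
    c≢0 = >-nonZero (<-trans (<-trans 0<a a<b) b<c)

  k₁≤a : k₁ ≤ a
  k₁≤a = subst (k₁ ≤_) k₁+m₀≡a (m≤m+n k₁ m₀)

  [1+i]a+x≢0 : ∀ i x → suc i * a + x ≢ 0
  [1+i]a+x≢0 i x e = <⇒≢ 0<a (sym (m+n≡0⇒m≡0 a (m+n≡0⇒m≡0 (a + i * a) e)))

  a≼k₁*b : a ≼ k₁ * b
  a≼k₁*b = from-coefficients i′ k₁*b≡
    where
    from-coefficients : ∀ i → k₁ * b ≡ i * a + k′ * c → a ≼ k₁ * b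
    from-coefficients (suc i₀) k₁*b≡ = subst (a ≼_) (sym (begin
      k₁ * b                      ≡⟨ k₁*b≡ ⟩
      suc i₀ * a + k′ * c         ≡⟨ solve (i₀ ∷ a ∷ b ∷ k′ ∷ c ∷ []) ⟩
      suc i₀ * a + 0 * b + k′ * c ∎)) (a≼ i₀ 0 k′)
      where open ≡-Reasoning
    from-coefficients zero k₁*b≡ = ⊥-elim (<⇒≱ (<-trans (≤-<-trans k₁≤a a<b) b<c) c≤k₁)
      where
      c≤k₁ : c ≤ k₁
      c≤k₁ = ∣⇒≤ ⦃ >-nonZero 0<k₁ ⦄ (coprime-divisor (Coprime.sym b⊥c) (divides k′ (trans (*-comm b k₁) k₁*b≡)))

  m₀≤k′ : m₀ ≤ k′
  m₀≤k′ = +-cancelʳ-≤ k₁ m₀ k′ (subst (_≤ k′ + k₁) (trans (sym k₁+m₀≡a) (+-comm k₁ m₀)) a≤k′+k₁)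
    where
    a∣c*[k′+k₁] : a ∣ c * (k′ + k₁)
    a∣c*[k′+k₁] = ∣m+n∣m⇒∣n (divides (k₁ * t) (begin
      i′ * a + c * (k′ + k₁)    ≡⟨ solve (i′ ∷ a ∷ c ∷ k′ ∷ k₁ ∷ []) ⟩
      (i′ * a + k′ * c) + k₁ * c ≡⟨ cong (_+ k₁ * c) (sym k₁*b≡) ⟩
      k₁ * b + k₁ * c           ≡⟨ solve (k₁ ∷ b ∷ c ∷ []) ⟩
      k₁ * (b + c)              ≡⟨ cong (k₁ *_) b+c≡t*a ⟩
      k₁ * (t * a)              ≡⟨ solve (k₁ ∷ t ∷ a ∷ []) ⟩
      k₁ * t * a                ∎)) (divides i′ refl)
      where open ≡-Reasoning
    a≤k′+k₁ : a ≤ k′ + k₁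
    a≤k′+k₁ = ∣⇒≤ ⦃ >-nonZero (≤-trans 0<k₁ (m≤n+m k₁ k′)) ⦄ (coprime-divisor a⊥c a∣c*[k′+k₁])

  -- From m c = (i + 1) a + j b: a ∣ (m + j) c, so a ≤ m + j and j ≥ k₁; substituting k₁ b = i′ a + k′ c
  -- then gives m > k′, whereas m ≤ m₀ ≤ k′.
  c-multiple-∉a+⟨a,b⟩ : ∀ {m} i j → m ≤ m₀ → m * c ≢ suc i * a + j * b
  c-multiple-∉a+⟨a,b⟩ {m} i j m≤m₀ m*c≡ = <⇒≱ (k′<m (m≤n⇒∃[o]m+o≡n k₁≤j)) (≤-trans m≤m₀ m₀≤k′)
    where
    a∣c*[m+j] : a ∣ c * (m + j)
    a∣c*[m+j] = divides (suc i + j * t) (begin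
      c * (m + j)               ≡⟨ solve (c ∷ m ∷ j ∷ []) ⟩
      m * c + j * c             ≡⟨ cong (_+ j * c) m*c≡ ⟩
      suc i * a + j * b + j * c ≡⟨ solve (i ∷ a ∷ j ∷ b ∷ c ∷ []) ⟩
      suc i * a + j * (b + c)   ≡⟨ cong (λ x → suc i * a + j * x) b+c≡t*a ⟩
      suc i * a + j * (t * a)   ≡⟨ solve (i ∷ a ∷ j ∷ t ∷ []) ⟩
      (suc i + j * t) * a       ∎)
      where open ≡-Reasoning
    m+j≢0 : NonZero (m + j)
    m+j≢0 with m + j in m+j≡
    ... | suc _ = _
    ... | zero = ⊥-elim ([1+i]a+x≢0 i (j * b) (trans (sym m*c≡) (cong (_* c) (m+n≡0⇒m≡0 m m+j≡))))
    a≤m+j : a ≤ m + j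
    a≤m+j = ∣⇒≤ ⦃ m+j≢0 ⦄ (coprime-divisor a⊥c a∣c*[m+j])
    k₁≤j : k₁ ≤ j
    k₁≤j = +-cancelʳ-≤ m₀ k₁ j (begin
      k₁ + m₀   ≡⟨ k₁+m₀≡a ⟩
      a         ≤⟨ a≤m+j ⟩
      m + j     ≤⟨ +-monoˡ-≤ j m≤m₀ ⟩
      m₀ + j    ≡⟨ +-comm m₀ j ⟩
      j + m₀    ∎)
      where open ≤-Reasoning
    k′<m : (∃ λ r → k₁ + r ≡ j) → k′ < m
    k′<m (r , k₁+r≡j) = *-cancelʳ-< c k′ m (begin-strict
      k′ * c                                      <⟨ m<m+n (k′ * c) (≤-trans 0<a (m≤m+n a _)) ⟩
      k′ * c + (a + (i * a + r * b + i′ * a))     ≡⟨ solve (k′ ∷ c ∷ a ∷ i ∷ r ∷ b ∷ i′ ∷ []) ⟩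
      suc i * a + r * b + (i′ * a + k′ * c)       ≡⟨ cong (suc i * a + r * b +_) (sym k₁*b≡) ⟩
      suc i * a + r * b + k₁ * b                  ≡⟨ solve (i ∷ a ∷ r ∷ b ∷ k₁ ∷ []) ⟩
      suc i * a + (k₁ + r) * b                    ≡⟨ cong (λ x → suc i * a + x * b) k₁+r≡j ⟩
      suc i * a + j * b                           ≡⟨ sym m*c≡ ⟩
      m * c                                       ∎)
      where open ≤-Reasoning

  c-multiple-∉a+S : ∀ {k} → k ≤ m₀ → ¬ (a ≼ k * c)
  c-multiple-∉a+S {k} k≤m₀ (_ , (i , j , k₂ , refl) , k*c≡) =
    let (q , k₂+q≡k) = m≤n⇒∃[o]m+o≡n k₂≤k in
    c-multiple-∉a+⟨a,b⟩ i j (≤-trans (subst (q ≤_) k₂+q≡k (m≤n+m q k₂)) k≤m₀) (q*c≡ q k₂+q≡k)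
    where
    open ≡-Reasoning
    k*c≡′ : k * c ≡ k₂ * c + (suc i * a + j * b)
    k*c≡′ = trans k*c≡ (solve (a ∷ i ∷ j ∷ b ∷ k₂ ∷ c ∷ []))
    k₂≤k : k₂ ≤ k
    k₂≤k = *-cancelʳ-≤ k₂ k c (subst (k₂ * c ≤_) (sym k*c≡′) (m≤m+n (k₂ * c) _))
    q*c≡ : ∀ q → k₂ + q ≡ k → q * c ≡ suc i * a + j * b
    q*c≡ q k₂+q≡k = +-cancelˡ-≡ (k₂ * c) _ _ (begin
      k₂ * c + q * c ≡⟨ solve (k₂ ∷ q ∷ c ∷ []) ⟩
      (k₂ + q) * c   ≡⟨ cong (_* c) k₂+q≡k ⟩
      k * c          ≡⟨ k*c≡′ ⟩
      k₂ * c + (suc i * a + j * b) ∎)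

  b-multiple-∉a+S : ∀ {j} → j < k₁ → ¬ (a ≼ j * b)
  b-multiple-∉a+S {j} j<k₁ (_ , (i , j₂ , k , refl) , j*b≡) =
    let (q , j₂+q≡j) = m≤n⇒∃[o]m+o≡n j₂≤j
        q*b≡ = q*b≡ q j₂+q≡j in
    k₁-minimal q (0<q q*b≡) (≤-<-trans (subst (q ≤_) j₂+q≡j (m≤n+m q j₂)) j<k₁) (suc i , k , q*b≡)
    where
    open ≡-Reasoning
    j*b≡′ : j * b ≡ j₂ * b + (suc i * a + k * c)
    j*b≡′ = trans j*b≡ (solve (a ∷ i ∷ j₂ ∷ b ∷ k ∷ c ∷ []))
    j₂≤j : j₂ ≤ j
    j₂≤j = *-cancelʳ-≤ j₂ j b (subst (j₂ * b ≤_) (sym j*b≡′) (m≤m+n (j₂ * b) _))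
    q*b≡ : ∀ q → j₂ + q ≡ j → q * b ≡ suc i * a + k * c
    q*b≡ q j₂+q≡j = +-cancelˡ-≡ (j₂ * b) _ _ (begin
      j₂ * b + q * b ≡⟨ solve (j₂ ∷ q ∷ b ∷ []) ⟩
      (j₂ + q) * b   ≡⟨ cong (_* b) j₂+q≡j ⟩
      j * b          ≡⟨ j*b≡′ ⟩
      j₂ * b + (suc i * a + k * c) ∎)
    0<q : ∀ {q} → q * b ≡ suc i * a + k * c → 0 < q
    0<q {zero} 0≡ = ⊥-elim ([1+i]a+x≢0 i (k * c) (sym 0≡))
    0<q {suc q} _ = s≤s z≤n

  a≼b+c : a ≼ b + c
  a≼b+c = from-quotient t b+c≡t*a
    where
    from-quotient : ∀ u → b + c ≡ u * a → a ≼ b + c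
    from-quotient zero b+c≡0 = ⊥-elim (<⇒≢ (<-trans 0<a a<b) (sym (m+n≡0⇒m≡0 b b+c≡0)))
    from-quotient (suc u) b+c≡ = u * a , S-* u S-a , b+c≡

  -- With p = k₁ − 1: (m₀ + 1) c = p b + a (c − t p) over ℤ. If c − t p ≤ 0 this puts p b in ⟨a, c⟩
  -- although p < k₁; otherwise (m₀ + 1) c ∈ a + S.
  a≼[1+m₀]*c : a ≼ suc m₀ * c
  a≼[1+m₀]*c = from-predecessor (m≤n⇒∃[o]m+o≡n 0<k₁)
    where
    open ≡-Reasoning
    from-predecessor : (∃ λ p → suc p ≡ k₁) → a ≼ suc m₀ * c
    from-predecessor (p , 1+p≡k₁) = compare (t * p ≤? c)
      where
      [1+m₀]c+pc≡ac : suc m₀ * c + p * c ≡ a * c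
      [1+m₀]c+pc≡ac = begin
        suc m₀ * c + p * c   ≡⟨ solve (m₀ ∷ c ∷ p ∷ []) ⟩
        (suc p + m₀) * c     ≡⟨ cong (λ k → (k + m₀) * c) 1+p≡k₁ ⟩
        (k₁ + m₀) * c        ≡⟨ cong (_* c) k₁+m₀≡a ⟩
        a * c                ∎
      pb+pc≡atp : p * b + p * c ≡ a * (t * p)
      pb+pc≡atp = begin
        p * b + p * c        ≡⟨ solve (p ∷ b ∷ c ∷ []) ⟩
        p * (b + c)          ≡⟨ cong (p *_) b+c≡t*a ⟩
        p * (t * a)          ≡⟨ solve (p ∷ t ∷ a ∷ []) ⟩
        a * (t * p)          ∎
      pb≢ : ∀ e → p * b ≢ suc m₀ * c + e * a
      pb≢ e pb≡ = k₁-minimal p 0<p (subst (p <_) 1+p≡k₁ ≤-refl) (e , suc m₀ , trans pb≡ (+-comm _ (e * a)))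
        where
        0<p : 0 < p
        0<p = n≢0⇒n>0 λ p≡0 → <⇒≢ (<-trans (<-trans 0<a a<b) b<c)
          (sym (m+n≡0⇒m≡0 c (m+n≡0⇒m≡0 (suc m₀ * c) (trans (sym pb≡) (cong (_* b) p≡0)))))
      from-remainder : ∀ e → suc m₀ * c ≡ p * b + a * e → a ≼ suc m₀ * c
      from-remainder zero [1+m₀]c≡ = ⊥-elim (pb≢ 0 (begin
        p * b               ≡⟨ solve (p ∷ b ∷ a ∷ []) ⟩
        p * b + a * 0       ≡⟨ sym [1+m₀]c≡ ⟩
        suc m₀ * c          ≡⟨ solve (m₀ ∷ c ∷ a ∷ []) ⟩
        suc m₀ * c + 0 * a  ∎))
      from-remainder (suc e) [1+m₀]c≡ = e * a + p * b , S-+ (S-* e S-a) (S-* p S-b) ,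
        trans [1+m₀]c≡ (solve (p ∷ b ∷ a ∷ e ∷ []))
      compare : Dec (t * p ≤ c) → a ≼ suc m₀ * c
      compare (yes tp≤c) = quotient-below (m≤n⇒∃[o]m+o≡n tp≤c)
        where
        quotient-below : (∃ λ e → t * p + e ≡ c) → a ≼ suc m₀ * c
        quotient-below (e , tp+e≡c) = from-remainder e (+-cancelʳ-≡ (p * c) _ _ (begin
          suc m₀ * c + p * c        ≡⟨ [1+m₀]c+pc≡ac ⟩
          a * c                     ≡⟨ cong (a *_) (sym tp+e≡c) ⟩
          a * (t * p + e)           ≡⟨ solve (a ∷ t ∷ p ∷ e ∷ []) ⟩
          a * (t * p) + a * e       ≡⟨ cong (_+ a * e) (sym pb+pc≡atp) ⟩
          p * b + p * c + a * e     ≡⟨ solve (p ∷ b ∷ c ∷ a ∷ e ∷ []) ⟩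
          p * b + a * e + p * c     ∎))
      compare (no tp≰c) = quotient-above (m≤n⇒∃[o]m+o≡n (≰⇒> tp≰c))
        where
        quotient-above : (∃ λ e → suc c + e ≡ t * p) → a ≼ suc m₀ * c
        quotient-above (e , 1+c+e≡tp) = ⊥-elim (pb≢ (suc e) (+-cancelʳ-≡ (p * c) _ _ (begin
          p * b + p * c                    ≡⟨ pb+pc≡atp ⟩
          a * (t * p)                      ≡⟨ cong (a *_) (sym 1+c+e≡tp) ⟩
          a * (suc c + e)                  ≡⟨ solve (a ∷ c ∷ e ∷ []) ⟩
          a * c + suc e * a                ≡⟨ cong (_+ suc e * a) (sym [1+m₀]c+pc≡ac) ⟩
          suc m₀ * c + p * c + suc e * a   ≡⟨ solve (m₀ ∷ c ∷ p ∷ e ∷ a ∷ []) ⟩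
          suc m₀ * c + suc e * a + p * c   ∎)))

  Apéry-classification : ∀ {x} → Apéry x →
    (∃ λ j → j < k₁ × x ≡ j * b) ⊎ (∃ λ k → k < m₀ × x ≡ suc k * c)
  Apéry-classification ((suc i , j , k , refl) , a⋠x) = ⊥-elim (a⋠x (a≼ i j k))
  Apéry-classification ((zero , suc j , suc k , refl) , a⋠x) =
    ⊥-elim (a⋠x (≼-≡-trans (≼-+ʳ a≼b+c (S-+ (S-* j S-b) (S-* k S-c))) regroup))
    where
    regroup : b + c + (j * b + k * c) ≡ suc j * b + suc k * c
    regroup = solve (j ∷ k ∷ b ∷ c ∷ [])
  Apéry-classification ((zero , j , zero , refl) , a⋠x) with j <? k₁
  ... | yes j<k₁ = inj₁ (j , j<k₁ , +-identityʳ (j * b))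
  ... | no j≮k₁ with r , refl ← m≤n⇒∃[o]m+o≡n (≮⇒≥ j≮k₁) =
    ⊥-elim (a⋠x (≼-≡-trans (≼-+ʳ a≼k₁*b (S-* r S-b)) regroup))
    where
    regroup : k₁ * b + r * b ≡ (k₁ + r) * b + 0
    regroup = solve (k₁ ∷ r ∷ b ∷ [])
  Apéry-classification ((zero , zero , suc k , refl) , a⋠x) with suc k ≤? m₀
  ... | yes k<m₀ = inj₂ (k , k<m₀ , refl)
  ... | no k≮m₀ with r , refl ← m≤n⇒∃[o]m+o≡n (≤-pred (≰⇒> k≮m₀)) =
    ⊥-elim (a⋠x (≼-≡-trans (≼-+ʳ a≼[1+m₀]*c (S-* r S-c)) (sym (*-distribʳ-+ c (suc m₀) r))))

  Apéry-count : Counts _≡_ Apéry a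
  Apéry-count = subst (Counts _≡_ Apéry) k₁+m₀≡a (Counts-cong to (λ _ → Apéry-classification)
    (Counts-⊎ disjoint
      (Counts-applyUpTo (_* b) k₁ (λ {i} {j} → *-cancelʳ-≡ i j b))
      (Counts-applyUpTo (λ k → suc k * c) m₀ (λ {i} {j} e → suc-injective (*-cancelʳ-≡ (suc i) (suc j) c e)))))
    where
    open ℕ-Counting
    disjoint : ∀ {x y} → (∃ λ j → j < k₁ × x ≡ j * b) → (∃ λ k → k < m₀ × y ≡ suc k * c) → x ≢ y
    disjoint (zero , _ , refl) (k , _ , refl) 0≡ = <⇒≢ (<-trans (<-trans 0<a a<b) b<c) (sym (m+n≡0⇒m≡0 c (sym 0≡)))
    disjoint (suc j , j<k₁ , refl) (k , _ , refl) jb≡ = k₁-minimal (suc j) (s≤s z≤n) j<k₁ (0 , suc k , jb≡)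
    to : ∀ x → (∃ λ j → j < k₁ × x ≡ j * b) ⊎ (∃ λ k → k < m₀ × x ≡ suc k * c) → Apéry x
    to _ (inj₁ (j , j<k₁ , refl)) = S-* j S-b , b-multiple-∉a+S j<k₁
    to _ (inj₂ (k , k<m₀ , refl)) = S-* (suc k) S-c , c-multiple-∉a+S k<m₀

  d₁₁ dₐ₁ : ℕ
  d₁₁ = c * m₀
  dₐ₁ = b * (k₁ ∸ 1)

  d₁₁-Apéry : Apéry d₁₁
  d₁₁-Apéry = subst Apéry (*-comm m₀ c) (S-* m₀ S-c , c-multiple-∉a+S ≤-refl)

  dₐ₁-Apéry : Apéry dₐ₁
  dₐ₁-Apéry = subst Apéry (*-comm (k₁ ∸ 1) b) (S-* (k₁ ∸ 1) S-b , b-multiple-∉a+S (∸-monoʳ-< {o = 0} (s≤s z≤n) 0<k₁))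

  Apéry-≼-corner : ∀ {x} → Apéry x → x ≼ d₁₁ ⊎ x ≼ dₐ₁
  Apéry-≼-corner apx with Apéry-classification apx
  ... | inj₁ (j , j<k₁ , refl) = inj₂ (≼-≡-trans (*-monoˡ-≼ S-b (∸-monoˡ-≤ 1 j<k₁)) (*-comm (k₁ ∸ 1) b))
  ... | inj₂ (k , k<m₀ , refl) = inj₁ (≼-≡-trans (*-monoˡ-≼ S-c k<m₀) (*-comm m₀ c))

shiftCoeff-≥ : ∀ {a n} f → a ≤ n → shiftCoeff a f n ≡ f (n ∸ a)
shiftCoeff-≥ {a} {n} f a≤n with a ≤ᵇ n | ≤ᵇ-reflects-≤ a n
... | true | _ = refl
... | false | ofⁿ a≰n = ⊥-elim (a≰n a≤n)

shiftCoeff-< : ∀ {a n} f → n < a → shiftCoeff a f n ≡ 0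
shiftCoeff-< {a} {n} f n<a with a ≤ᵇ n | ≤ᵇ-reflects-≤ a n
... | true | ofʸ a≤n = ⊥-elim (<⇒≱ n<a a≤n)
... | false | _ = refl

module Recurrence (a b c : ℕ) (0<a : 0 < a) (a<b : a < b) (b<c : b < c)
  (a⊥c : Coprime a c) (b⊥c : Coprime b c) (t : ℕ) (b+c≡t*a : b + c ≡ t * a)
  (k₁ : ℕ) (0<k₁ : 0 < k₁) (i′ k′ : ℕ) (k₁*b≡ : k₁ * b ≡ i′ * a + k′ * c)
  (k₁-minimal : ∀ q → 0 < q → q < k₁ → ¬ InS2 a c (q * b)) where

  open AperySet a b c 0<a a<b b<c a⊥c b⊥c t b+c≡t*a k₁ 0<k₁ i′ k′ k₁*b≡ k₁-minimal
         (a ∸ k₁) (m+[n∸m]≡n (least-multiple-≤ 0<a k₁-minimal))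
  open Semigroup a b c
  open ≐-Counting

  Corner : Subset → Set
  Corner I = I d₁₁ ≡ true ⊎ I dₐ₁ ≡ true

  Corner? : Decidable Corner
  Corner? I = I d₁₁ Boolₚ.≟ true ⊎-dec I dₐ₁ Boolₚ.≟ true

  N R : ℕ → ℕ
  N n = length (ideals n)
  R n = length (filter Corner? (ideals n))

  N-counts : ∀ n → Counts _≐_ (IdealOfCodim n) (N n)
  N-counts n = ideals n , refl , ideals-enumerate n

  R-counts : ∀ n → Counts _≐_ (λ I → InR1 a b c k₁ I × Codim I n) (R n)
  R-counts n = Counts-cong (λ I ((ideal , codim) , corner) → (ideal , corner) , codim)
                           (λ I ((ideal , corner) , codim) → (ideal , codim) , corner)
    (filter Corner? (ideals n) , refl , Enumerates-filter Corner? corner-cong (ideals-enumerate n))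
    where
    corner-cong : ∀ {I J} → IdealOfCodim n I → Corner I → I ≐ J → Corner J
    corner-cong _ (inj₁ I₁₁) I≐J = inj₁ (trans (sym (I≐J d₁₁)) I₁₁)
    corner-cong _ (inj₂ Iₐ₁) I≐J = inj₂ (trans (sym (I≐J dₐ₁)) Iₐ₁)

  avoids-corners⇒avoids-Apéry : ∀ {I} → Ideal I → ¬ Corner I → Avoids I Apéry
  avoids-corners⇒avoids-Apéry {I} ideal ¬corner {x} apx with I x in Ix
  ... | false = refl
  ... | true = ⊥-elim (¬corner (Sum.map (ideal-upward-closed ideal Ix) (ideal-upward-closed ideal Ix)
                                   (Apéry-≼-corner apx)))

  avoiding-counts : ∀ n → Counts _≐_ (λ I → IdealOfCodim n I × Avoids I Apéry) (shiftCoeff a N n)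
  avoiding-counts n with a ≤? n
  ... | yes a≤n = subst₂ (λ m → Counts _≐_ (λ I → IdealOfCodim m I × Avoids I Apéry))
                    (m+[n∸m]≡n a≤n) (sym (shiftCoeff-≥ N a≤n))
                    (avoiding-ideals-count Apéry-count (N-counts (n ∸ a)))
  ... | no a≰n = subst (Counts _≐_ _) (sym (shiftCoeff-< N (≰⇒> a≰n)))
                   (Counts-∅ λ I ((ideal , codim) , avoids) → a≰n (proj₁ (unshift-codim Apéry-count ideal avoids codim)))

  recurrence : ∀ n → N n ≡ R n + shiftCoeff a N n
  recurrence n = Counts-unique (N-counts n) (Counts-cong to from (Counts-⊎ disjoint (R-counts n) (avoiding-counts n)))
    where
    disjoint : ∀ {I J} → InR1 a b c k₁ I × Codim I n → IdealOfCodim n J × Avoids J Apéry → ¬ (I ≐ J)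
    disjoint ((_ , inj₁ I₁₁) , _) (_ , avoids) I≐J = true≢false (trans (sym I₁₁) (trans (I≐J d₁₁) (avoids d₁₁-Apéry)))
    disjoint ((_ , inj₂ Iₐ₁) , _) (_ , avoids) I≐J = true≢false (trans (sym Iₐ₁) (trans (I≐J dₐ₁) (avoids dₐ₁-Apéry)))
    to : ∀ I → (InR1 a b c k₁ I × Codim I n) ⊎ (IdealOfCodim n I × Avoids I Apéry) → IdealOfCodim n I
    to I (inj₁ ((ideal , _) , codim)) = ideal , codim
    to I (inj₂ (idealOfCodim , _)) = idealOfCodim
    from : ∀ I → IdealOfCodim n I → (InR1 a b c k₁ I × Codim I n) ⊎ (IdealOfCodim n I × Avoids I Apéry)
    from I (ideal , codim) with Corner? I
    ... | yes corner = inj₁ ((ideal , corner) , codim)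
    ... | no ¬corner = inj₂ ((ideal , codim) , avoids-corners⇒avoids-Apéry ideal ¬corner)

theorem4p3 : (a b c k₁ : ℕ) → 0 < a → a < b → b < c →
    Coprime a b → Coprime a c → Coprime b c → a ∣ b + c →
    IsK1 a b c k₁ →
    Σ (ℕ → ℕ) λ N → Σ (ℕ → ℕ) λ R →
    (∀ n → Counts _≐_ (λ I → IsIdeal a b c I × CodimIs a b c I n) (N n))
    × (∀ n → Counts _≐_ (λ I → InR1 a b c k₁ I × CodimIs a b c I n) (R n))
    × (∀ n → N n ≡ R n + shiftCoeff a N n)
theorem4p3 a b c k₁ 0<a a<b b<c _ a⊥c b⊥c (divides t b+c≡t*a) (0<k₁ , (i′ , k′ , k₁*b≡) , k₁-minimal) =
  N , R , N-counts , R-counts , recurrence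
  where
  open Recurrence a b c 0<a a<b b<c a⊥c b⊥c t b+c≡t*a k₁ 0<k₁ i′ k′ k₁*b≡ k₁-minimal
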